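{- Let $b$ and $t$ be positive integers, and let $G$ and $H$ be finite simple undirected graphs. If $H$ has bandwidth at most $b$ and $H$ is a $t$-sketch of $G$, then the bandwidth of $G$ is at most $t(b+1)$.
   Context: For a positive integer $k$, $[k] = \{1, \dots, k\}$. For an $n$-vertex graph $G=(V,E)$, the width of a bijection $\pi\colon V \to [n]$ is $\max_{\{u,v\}\in E} |\pi(u)-\pi(v)|$, and the bandwidth of $G$ is the minimum width over all such bijections. For a positive integer $t$, a graph $H$ is a $t$-sketch of a graph $G$ if there exists a mapping $f\colon V(G)\to V(H)$ such that $|f^{ -1}(v)| \le t$ for every $v \in V(H)$, and for every edge $\{u,v\}\in E(G)$ either $f(u)=f(v)$ or $\{f(u),f(v)\}\in E(H)$. -}

module Defs where

open import Data.Nat using (ℕ; _≤_)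
open import Data.Nat.Base using (∣_-_∣)
open import Data.Fin using (Fin; toℕ)
open import Data.Fin.Subset using (Subset; ∣_∣)
open import Data.Vec using (tabulate)
open import Data.Bool using (Bool)
open import Data.Product using (Σ; _×_; ∃-syntax)
open import Data.Sum using (_⊎_)
open import Function.Bundles using (_⤖_; Bijection)
open import Relation.Nullary using (¬_; does)
open import Relation.Binary.PropositionalEquality using (_≡_)
open import Data.Fin using (_≟_)
open import Level using (0ℓ)

record Graph : Set₁ where
  field
    n     : ℕ
    Adj   : Fin n → Fin n → Set
    sym   : ∀ {u v} → Adj u v → Adj v u
    irrefl : ∀ {u} → ¬ Adj u u
open Graph public

-- Positions [n] = {1..n} are modelled as Fin n = {0..n-1}; differences
-- of positions are unchanged by this shift.
Width≤ : (G : Graph) → (Fin (n G) ⤖ Fin (n G)) → ℕ → Set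
Width≤ G π w = ∀ u v → Adj G u v →
  ∣ toℕ (Bijection.to π u) - toℕ (Bijection.to π v) ∣ ≤ w

Bandwidth≤ : Graph → ℕ → Set
Bandwidth≤ G w = ∃[ π ] Width≤ G π w

fibre : ∀ {m k} → (Fin m → Fin k) → Fin k → Subset m
fibre f v = tabulate (λ u → does (f u ≟ v))

IsSketch : ℕ → Graph → Graph → Set
IsSketch t H G = Σ (Fin (n G) → Fin (n H)) λ f →
  (∀ v → ∣ fibre f v ∣ ≤ t) ×
  (∀ u v → Adj G u v → (f u ≡ f v) ⊎ Adj H (f u) (f v))

-- Order the vertices of G lexicographically by (position of f v in the layout of H, v).
-- If u and v are adjacent and u comes first, every vertex strictly between them is mapped
-- to one of the b + 1 positions p, ..., p + b, where p is the position of f u; each of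
-- these positions carries at most t vertices, so u and v end up at most t (b + 1) apart.
module Submission where

open import Defs hiding (sym)
open import Data.Nat using (ℕ; zero; suc; _*_; _+_; _≤_; _<_; z≤n; s≤s; _≤?_)
open import Data.Nat.Base using (∣_-_∣)
open import Data.Nat.Properties
open import Algebra.Properties.CommutativeSemigroup +-commutativeSemigroup using (interchange)
open import Data.Fin as Fin using (Fin; toℕ; fromℕ<; punchOut; combine)
open import Data.Fin.Properties as Finₚ
  using (toℕ-injective; toℕ-fromℕ<; punchOut-injective; any?; injective⇒≤; combine-injective; combine-monoˡ-<)
open import Data.Fin.Subset using (∣_∣)
open import Data.Product using (∃-syntax; _×_; _,_; proj₂)
open import Data.Sum using (_⊎_; inj₁; inj₂)
open import Data.Unit using (tt)
open import Function using (_∘_)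
open import Function.Bundles using (_⤖_; Bijection; mk⤖)
open import Function.Definitions using (Injective; Surjective)
open import Relation.Nullary using (Dec; yes; no; ¬_; contradiction)
open import Relation.Nullary.Decidable using (_×-dec_)
open import Level using (0ℓ)
open import Relation.Unary using (Pred; Decidable; Empty; _⊆_; _∪_)
open import Relation.Unary.Properties using (U?)
open import Relation.Binary using (tri<; tri≈; tri>)
open import Relation.Binary.PropositionalEquality
  using (_≡_; refl; sym; trans; cong; subst)

private
  variable
    k : ℕ
    A B C : Set
    P Q R : Pred (Fin k) 0ℓ

indicator : Dec A → ℕ
indicator (yes _) = 1
indicator (no _)  = 0

indicator-mono : (A → B) → (A? : Dec A) (B? : Dec B) → indicator A? ≤ indicator B?
indicator-mono A⇒B (yes a) (yes _) = ≤-refl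
indicator-mono A⇒B (yes a) (no ¬b) = contradiction (A⇒B a) ¬b
indicator-mono A⇒B (no _)  _       = z≤n

indicator-mono-< : B → ¬ A → (A? : Dec A) (B? : Dec B) → indicator A? < indicator B?
indicator-mono-< b ¬a (yes a) _       = contradiction a ¬a
indicator-mono-< b ¬a (no _)  (yes _) = s≤s z≤n
indicator-mono-< b ¬a (no _)  (no ¬b) = contradiction b ¬b

indicator-∪ : (A → B ⊎ C) → (A? : Dec A) (B? : Dec B) (C? : Dec C) →
              indicator A? ≤ indicator B? + indicator C?
indicator-∪ A⇒B∪C (no _)  _       _       = z≤n
indicator-∪ A⇒B∪C (yes a) (yes _) _       = s≤s z≤n
indicator-∪ A⇒B∪C (yes a) (no ¬b) C? with A⇒B∪C a
... | inj₁ b = contradiction b ¬b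
... | inj₂ c = indicator-mono (λ _ → c) (yes a) C?

count : {P : Pred (Fin k) 0ℓ} → Decidable P → ℕ
count {zero}  P? = 0
count {suc k} P? = indicator (P? Fin.zero) + count (P? ∘ Fin.suc)

count-mono : (P? : Decidable P) (Q? : Decidable Q) → P ⊆ Q → count P? ≤ count Q?
count-mono {zero}  P? Q? P⊆Q = z≤n
count-mono {suc k} P? Q? P⊆Q =
  +-mono-≤ (indicator-mono P⊆Q (P? Fin.zero) (Q? Fin.zero)) (count-mono (P? ∘ Fin.suc) (Q? ∘ Fin.suc) P⊆Q)

count-mono-< : (P? : Decidable P) (Q? : Decidable Q) → P ⊆ Q →
               ∀ y → Q y → ¬ P y → count P? < count Q?
count-mono-< P? Q? P⊆Q Fin.zero Qy ¬Py =
  +-mono-<-≤ (indicator-mono-< Qy ¬Py (P? Fin.zero) (Q? Fin.zero)) (count-mono (P? ∘ Fin.suc) (Q? ∘ Fin.suc) P⊆Q)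
count-mono-< P? Q? P⊆Q (Fin.suc y) Qy ¬Py =
  +-mono-≤-< (indicator-mono P⊆Q (P? Fin.zero) (Q? Fin.zero))
             (count-mono-< (P? ∘ Fin.suc) (Q? ∘ Fin.suc) P⊆Q y Qy ¬Py)

count-∪ : (P? : Decidable P) (Q? : Decidable Q) (R? : Decidable R) →
          P ⊆ Q ∪ R → count P? ≤ count Q? + count R?
count-∪ {zero}  P? Q? R? P⊆Q∪R = z≤n
count-∪ {suc k} P? Q? R? P⊆Q∪R = begin
  indicator (P? Fin.zero) + count (P? ∘ Fin.suc)
    ≤⟨ +-mono-≤ (indicator-∪ P⊆Q∪R (P? Fin.zero) (Q? Fin.zero) (R? Fin.zero))
                (count-∪ (P? ∘ Fin.suc) (Q? ∘ Fin.suc) (R? ∘ Fin.suc) P⊆Q∪R) ⟩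
  (indicator (Q? Fin.zero) + indicator (R? Fin.zero)) + (count (Q? ∘ Fin.suc) + count (R? ∘ Fin.suc))
    ≡⟨ interchange (indicator (Q? Fin.zero)) _ _ _ ⟩
  count Q? + count R? ∎
  where open ≤-Reasoning

count-Empty : (P? : Decidable P) → Empty P → count P? ≡ 0
count-Empty {zero}  P? ∅ = refl
count-Empty {suc k} P? ∅ with P? Fin.zero
... | yes p = contradiction p (∅ Fin.zero)
... | no _  = count-Empty (P? ∘ Fin.suc) (∅ ∘ Fin.suc)

count-U : count {k} U? ≡ k
count-U {zero}  = refl
count-U {suc k} = cong suc (count-U {k})

count-fibre : ∀ {m k} (f : Fin m → Fin k) v → ∣ fibre f v ∣ ≡ count (λ u → f u Fin.≟ v)
count-fibre {zero}  f v = refl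
count-fibre {suc m} f v with f Fin.zero Fin.≟ v
... | yes _ = cong suc (count-fibre (f ∘ Fin.suc) v)
... | no _  = count-fibre (f ∘ Fin.suc) v

-- A point outside the image yields, by punching it out, an injection Fin (suc k) → Fin k.
injective⇒surjective : (g : Fin k → Fin k) → Injective _≡_ _≡_ g → ∀ y → ∃[ x ] g x ≡ y
injective⇒surjective {suc k} g g-inj y with any? (λ x → g x Fin.≟ y)
... | yes hit = hit
... | no miss = contradiction (injective⇒≤ punched-injective) (1+n≰n {k})
  where
  avoids : ∀ x → y ≡ g x → _
  avoids x y≡gx = miss (x , sym y≡gx)

  punched-injective : Injective _≡_ _≡_ (λ x → punchOut (avoids x))
  punched-injective eq = g-inj (punchOut-injective (avoids _) (avoids _) eq)

injective⇒bijection : (g : Fin k → Fin k) → Injective _≡_ _≡_ g → Fin k ⤖ Fin k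
injective⇒bijection g g-inj = mk⤖ (g-inj , surjective)
  where
  surjective : Surjective _≡_ _≡_ g
  surjective y with x , gx≡y ← injective⇒surjective g g-inj y = x , λ { refl → gx≡y }

module Ranking {N K : ℕ} (key : Fin N → Fin K) where

  rank : Fin N → ℕ
  rank v = count (λ w → key w Finₚ.<? key v)

  rank<N : ∀ v → rank v < N
  rank<N v = subst (rank v <_) count-U
    (count-mono-< (λ w → key w Finₚ.<? key v) U? _ v tt (<-irrefl refl))

  rankFin : Fin N → Fin N
  rankFin v = fromℕ< (rank<N v)

  toℕ-rankFin : ∀ v → toℕ (rankFin v) ≡ rank v
  toℕ-rankFin v = toℕ-fromℕ< (rank<N v)

  rank-mono-≤ : ∀ {u v} → key u Fin.≤ key v → rank u ≤ rank v
  rank-mono-≤ {u} {v} ku≤kv = count-mono (λ w → key w Finₚ.<? key u) (λ w → key w Finₚ.<? key v)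
    (λ kw<ku → <-≤-trans kw<ku ku≤kv)

  rank-mono-< : ∀ {u v} → key u Fin.< key v → rank u < rank v
  rank-mono-< {u} {v} ku<kv = count-mono-< (λ w → key w Finₚ.<? key u) (λ w → key w Finₚ.<? key v)
    (λ kw<ku → <-trans kw<ku ku<kv) u ku<kv (<-irrefl refl)

  between? : ∀ u v → Decidable (λ w → key u Fin.≤ key w × key w Fin.< key v)
  between? u v w = (key u Finₚ.≤? key w) ×-dec (key w Finₚ.<? key v)

  rank-gap : ∀ u v → rank v ≤ rank u + count (between? u v)
  rank-gap u v = count-∪ _ (λ w → key w Finₚ.<? key u) (between? u v) below-u-or-between
    where
    below-u-or-between : ∀ {w} → key w Fin.< key v →
                         key w Fin.< key u ⊎ (key u Fin.≤ key w × key w Fin.< key v)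
    below-u-or-between {w} kw<kv with key w Finₚ.<? key u
    ... | yes kw<ku = inj₁ kw<ku
    ... | no  kw≮ku = inj₂ (≮⇒≥ kw≮ku , kw<kv)

  rank-injective : ∀ {u v} → rank u ≡ rank v → key u ≡ key v
  rank-injective {u} {v} ru≡rv with Finₚ.<-cmp (key u) (key v)
  ... | tri< ku<kv _ _ = contradiction ru≡rv (<⇒≢ (rank-mono-< ku<kv))
  ... | tri≈ _ ku≡kv _ = ku≡kv
  ... | tri> _ _ kv<ku = contradiction (sym ru≡rv) (<⇒≢ (rank-mono-< kv<ku))

  rankFin-injective : Injective _≡_ _≡_ key → Injective _≡_ _≡_ rankFin
  rankFin-injective key-inj {u} {v} eq =
    key-inj (rank-injective (trans (sym (toℕ-rankFin u)) (trans (cong toℕ eq) (toℕ-rankFin v))))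

window? : ∀ {N} (g : Fin N → ℕ) p d → Decidable (λ w → p ≤ g w × g w ≤ p + d)
window? g p d w = (p ≤? g w) ×-dec (g w ≤? p + d)

module _ {N t : ℕ} (g : Fin N → ℕ) (level≤t : ∀ k → count (λ w → g w ≟ k) ≤ t) where

  count-window : ∀ p d → count (window? g p d) ≤ t * suc d
  count-window p zero = begin
    count (window? g p 0)   ≤⟨ count-mono (window? g p 0) (λ w → g w ≟ p) at-p ⟩
    count (λ w → g w ≟ p)   ≤⟨ level≤t p ⟩
    t                       ≡⟨ sym (*-identityʳ t) ⟩
    t * 1                   ∎
    where
    open ≤-Reasoning
    at-p : ∀ {w} → p ≤ g w × g w ≤ p + 0 → g w ≡ p
    at-p (p≤gw , gw≤p+0) = ≤-antisym (subst (g _ ≤_) (+-identityʳ p) gw≤p+0) p≤gw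
  count-window p (suc d) = begin
    count (window? g p (suc d))
      ≤⟨ count-∪ _ (window? g p d) (λ w → g w ≟ p + suc d) split ⟩
    count (window? g p d) + count (λ w → g w ≟ p + suc d)
      ≤⟨ +-mono-≤ (count-window p d) (level≤t (p + suc d)) ⟩
    t * suc d + t     ≡⟨ +-comm (t * suc d) t ⟩
    t + t * suc d     ≡⟨ sym (*-suc t (suc d)) ⟩
    t * suc (suc d)   ∎
    where
    open ≤-Reasoning
    split : ∀ {w} → p ≤ g w × g w ≤ p + suc d → (p ≤ g w × g w ≤ p + d) ⊎ g w ≡ p + suc d
    split {w} (p≤gw , gw≤p+1+d) with g w ≤? p + d
    ... | yes gw≤p+d = inj₁ (p≤gw , gw≤p+d)
    ... | no  gw≰p+d = inj₂ (≤-antisym gw≤p+1+d (subst (_≤ g w) (sym (+-suc p d)) (≰⇒> gw≰p+d)))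

m≤n≤m+o⇒∣m-n∣≤o : ∀ {m n o} → m ≤ n → n ≤ m + o → ∣ m - n ∣ ≤ o
m≤n≤m+o⇒∣m-n∣≤o {m} {n} m≤n n≤m+o =
  subst (_≤ _) (sym (m≤n⇒∣m-n∣≡n∸m m≤n)) (m≤n+o⇒m∸n≤o n m n≤m+o)

refine-layout : ∀ {N M t} (pos : Fin N → Fin M) → (∀ j → count (λ w → pos w Fin.≟ j) ≤ t) →
  ∃[ σ ] ∀ u v b → ∣ toℕ (pos u) - toℕ (pos v) ∣ ≤ b →
    ∣ toℕ (Bijection.to σ u) - toℕ (Bijection.to σ v) ∣ ≤ t * (b + 1)
refine-layout {N} {M} {t} pos fibre≤t = σ , stretch
  where
  -- toℕ (combine i w) = N * toℕ i + toℕ w: keys order by pos first, ties broken by w.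
  key : Fin N → Fin (M * N)
  key w = combine (pos w) w

  open Ranking key

  key-injective : Injective _≡_ _≡_ key
  key-injective {u} {v} eq = proj₂ (combine-injective (pos u) u (pos v) v eq)

  pos-mono : ∀ {u v} → key u Fin.≤ key v → toℕ (pos u) ≤ toℕ (pos v)
  pos-mono {u} {v} ku≤kv with toℕ (pos u) ≤? toℕ (pos v)
  ... | yes pu≤pv = pu≤pv
  ... | no  pu≰pv = contradiction ku≤kv (<⇒≱ (combine-monoˡ-< v u (≰⇒> pu≰pv)))

  value≤t : ∀ k → count (λ w → toℕ (pos w) ≟ k) ≤ t
  value≤t k with any? (λ w → toℕ (pos w) ≟ k)
  ... | yes (w₀ , refl) =
    ≤-trans (count-mono _ (λ w → pos w Fin.≟ pos w₀) toℕ-injective) (fibre≤t (pos w₀))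
  ... | no  none        = subst (_≤ t) (sym (count-Empty _ (λ w pw≡k → none (w , pw≡k)))) z≤n

  σ : Fin N ⤖ Fin N
  σ = injective⇒bijection rankFin (rankFin-injective key-injective)

  ordered-stretch : ∀ {u v b} → key u Fin.≤ key v → toℕ (pos v) ≤ toℕ (pos u) + b →
                    ∣ rank u - rank v ∣ ≤ t * (b + 1)
  ordered-stretch {u} {v} {b} ku≤kv pv≤pu+b = m≤n≤m+o⇒∣m-n∣≤o (rank-mono-≤ ku≤kv) (begin
    rank v
      ≤⟨ rank-gap u v ⟩
    rank u + count (between? u v)
      ≤⟨ +-monoʳ-≤ (rank u) (count-mono (between? u v) (window? (toℕ ∘ pos) (toℕ (pos u)) b) in-window) ⟩
    rank u + count (window? (toℕ ∘ pos) (toℕ (pos u)) b)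
      ≤⟨ +-monoʳ-≤ (rank u) (count-window (toℕ ∘ pos) value≤t (toℕ (pos u)) b) ⟩
    rank u + t * suc b
      ≡⟨ cong (λ c → rank u + t * c) (+-comm 1 b) ⟩
    rank u + t * (b + 1) ∎)
    where
    open ≤-Reasoning
    in-window : ∀ {w} → key u Fin.≤ key w × key w Fin.< key v →
                toℕ (pos u) ≤ toℕ (pos w) × toℕ (pos w) ≤ toℕ (pos u) + b
    in-window (ku≤kw , kw<kv) = pos-mono ku≤kw , ≤-trans (pos-mono (<⇒≤ kw<kv)) pv≤pu+b

  stretch : ∀ u v b → ∣ toℕ (pos u) - toℕ (pos v) ∣ ≤ b →
            ∣ toℕ (rankFin u) - toℕ (rankFin v) ∣ ≤ t * (b + 1)
  stretch u v b ∣pu-pv∣≤b rewrite toℕ-rankFin u | toℕ-rankFin v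
    with ≤-total (toℕ (key u)) (toℕ (key v))
  ... | inj₁ ku≤kv = ordered-stretch ku≤kv
                       (≤-trans (m≤n+∣n-m∣ (toℕ (pos v)) (toℕ (pos u))) (+-monoʳ-≤ _ ∣pu-pv∣≤b))
  ... | inj₂ kv≤ku = subst (_≤ _) (∣-∣-comm (rank v) (rank u)) (ordered-stretch kv≤ku
                       (≤-trans (m≤n+∣m-n∣ (toℕ (pos u)) (toℕ (pos v))) (+-monoʳ-≤ _ ∣pu-pv∣≤b)))

lemma2 : (b t : ℕ) → 1 ≤ b → 1 ≤ t → (G H : Graph) →
    Bandwidth≤ H b → IsSketch t H G → Bandwidth≤ G (t * (b + 1))
lemma2 b t _ _ G H (πH , πH-width≤b) (f , fibre≤t , edge⇒same∨adjacent) =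
  let σ , stretch = refine-layout pos pos-fibre≤t
  in  σ , λ u v uv → stretch u v b (image-distance uv)
  where
  pos : Fin (n G) → Fin (n H)
  pos = Bijection.to πH ∘ f

  pos-fibre≤t : ∀ j → count (λ w → pos w Fin.≟ j) ≤ t
  pos-fibre≤t j with v , πHv≡j ← Bijection.surjective πH j = begin
    count (λ w → pos w Fin.≟ j)
      ≤⟨ count-mono _ (λ w → f w Fin.≟ v)
                    (λ pw≡j → Bijection.injective πH (trans pw≡j (sym (πHv≡j refl)))) ⟩
    count (λ w → f w Fin.≟ v)     ≡⟨ sym (count-fibre f v) ⟩
    ∣ fibre f v ∣                 ≤⟨ fibre≤t v ⟩
    t                             ∎
    where open ≤-Reasoning

  image-distance : ∀ {u v} → Adj G u v → ∣ toℕ (pos u) - toℕ (pos v) ∣ ≤ b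
  image-distance {u} {v} uv with edge⇒same∨adjacent u v uv
  ... | inj₁ fu≡fv = subst (_≤ b) (sym (m≡n⇒∣m-n∣≡0 (cong (toℕ ∘ Bijection.to πH) fu≡fv))) z≤n
  ... | inj₂ adj   = πH-width≤b (f u) (f v) adj
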